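{- Assume Dickson's conjecture (D). Let $f_i(x)=a_ix+b_i$ for $i<k$ with $a_i,b_i\in\mathbb{Z}$, $a_i\ge1$, and let $g_j(x)=c_jx+d_j$ for $j<k'$ with $c_j,d_j\in\mathbb{Z}$, $c_j\ge 1$. Suppose that no integer $n>1$ divides $\prod_{i<k}f_i(s)$ for every integer $s$, and that $(a_i,b_i)\neq(c_j,d_j)$ for all $i<k$, $j<k'$. Then there are infinitely many natural numbers $m$ such that $f_i(m)$ is prime for all $i<k$ and $g_j(m)$ is composite for all $j<k'$.
   Context: Dickson's conjecture (D): for every $k\ge 1$ and every sequence $\bar f=\langle f_i : i<k\rangle$ of linear maps $f_i(x)=a_ix+b_i$ with $a_i,b_i$ non-negative integers and $a_i\ge 1$, if there is no integer $n>1$ dividing $\prod_{i<k} f_i(s)$ for every non-negative integer $s$, then there are infinitely many natural numbers $m$ such that $f_i(m)$ is prime for all $i<k$. -}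

module Defs where

open import Data.Nat as ℕ using (ℕ; zero; suc)
open import Data.Nat.Primality using (Prime; Composite)
open import Data.Nat.Divisibility using (_∣_)
open import Data.Fin using (Fin; zero; suc)
open import Data.Integer as ℤ using (ℤ; +_)
open import Data.Product using (Σ; _×_; ∃)
open import Relation.Binary.PropositionalEquality using (_≡_)
open import Relation.Nullary using (¬_)

∏ℕ : (k : ℕ) → (Fin k → ℕ) → ℕ
∏ℕ zero    x = 1
∏ℕ (suc k) x = x zero ℕ.* ∏ℕ k (λ i → x (suc i))

∏ℤ : (k : ℕ) → (Fin k → ℤ) → ℤ
∏ℤ zero    x = + 1
∏ℤ (suc k) x = x zero ℤ.* ∏ℤ k (λ i → x (suc i))

InfinitelyMany : (ℕ → Set) → Set
InfinitelyMany P = ∀ N → Σ ℕ λ m → N ℕ.≤ m × P m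

IsPrimeℤ : ℤ → Set
IsPrimeℤ z = Σ ℕ λ p → z ≡ + p × Prime p

IsCompositeℤ : ℤ → Set
IsCompositeℤ z = Σ ℕ λ n → z ≡ + n × Composite n

Dickson : Set
Dickson =
  (k : ℕ) (a b : Fin k → ℕ) →
  (∀ i → 1 ℕ.≤ a i) →
  ¬ (Σ ℕ λ n → 1 ℕ.< n × (∀ (s : ℕ) → n ∣ ∏ℕ k (λ i → a i ℕ.* s ℕ.+ b i))) →
  InfinitelyMany (λ m → ∀ i → Prime (a i ℕ.* m ℕ.+ b i))

module Submission where

open import Defs
open import Data.Nat using (ℕ)
open import Data.Fin using (Fin)
open import Data.Integer using (ℤ; +_; _*_; _+_; _≤_; _<_)
open import Data.Integer.Divisibility using (_∣_)
open import Data.Product using (Σ; _×_; _,_)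
open import Relation.Binary.PropositionalEquality using (_≡_)
open import Relation.Nullary using (¬_)

open import Data.Fin using (zero; suc)
open import Data.Fin.Properties using (any?)
open import Data.Integer using (-[1+_]; -_; _-_; ∣_∣; _^_; +≤+; +<+)
import Data.Integer.Properties as ℤₚ
open import Data.Integer.Divisibility.Signed as Signed using () renaming (_∣_ to _∣ˢ_)
open import Data.Integer.Tactic.RingSolver using (solve-∀)
import Data.Nat as ℕ
import Data.Nat.Properties as ℕₚ
import Data.Nat.Divisibility as ℕ∣
import Data.Nat.Tactic.RingSolver as ℕRing
open import Data.Nat.Coprimality using (Coprime; coprime-Bézout; 1-coprimeTo)
open import Data.Nat.GCD using (module Bézout)
open import Data.Nat.Primality using (Prime; Composite; euclidsLemma; ¬prime[0]; ¬prime[1])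
open import Data.Nat.Divisibility.Core using (hasNonTrivialDivisor)
open import Data.Product using (proj₁; proj₂)
open import Data.Sum using (_⊎_; inj₁; inj₂; [_,_])
open import Data.Empty using (⊥-elim)
open import Relation.Nullary using (yes; no)
open import Relation.Binary.PropositionalEquality using (refl; sym; trans; cong; cong₂; subst; module ≡-Reasoning)

-- We look for m in an arithmetic progression
-- R + M ℕ, and handle each form g(x) = c x + d in one of two ways.
--   * If g is a rational multiple of some f i (a i d = b i c) but not equal
--     to it, then c f i (m) = a i g(m), so once f i (m) is a prime q > a i,
--     q properly divides g(m) and g(m) is composite.
--   * Otherwise, written in the variable x of m = R + M x, the forms have
--     non-zero resultants c M (a i R + b i) − (c R + d) a i M.  With K their
--     product, p = 1 + K² c M is coprime to the values of the f i at the
--     shift t = K² (c R + d), so the refined progression x = p y + t keeps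
--     the f i free of fixed divisors, while p divides g(m) on it.
-- Handling the g j one after another gives a progression on which every g j
-- is dealt with.  Dickson's conjecture for the forms x ↦ f i (R + M x),
-- whose coefficients are natural numbers, then gives arbitrarily large x
-- with all f i (m) prime, and for m large every g j (m) is composite.

∏-cong : ∀ k {x y : Fin k → ℤ} → (∀ i → x i ≡ y i) → ∏ℤ k x ≡ ∏ℤ k y
∏-cong ℕ.zero    eq = refl
∏-cong (ℕ.suc k) eq = cong₂ _*_ (eq zero) (∏-cong k (λ i → eq (suc i)))

∏-congruent : ∀ k (n : ℤ) (x y : Fin k → ℤ) →
              (∀ i → n ∣ˢ x i - y i) → n ∣ˢ ∏ℤ k x - ∏ℤ k y
∏-congruent ℕ.zero    n x y h = Signed.divides (+ 0) (sym (ℤₚ.*-zeroˡ n))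
∏-congruent (ℕ.suc k) n x y h =
  subst (n ∣ˢ_) (sym (split (x zero) (y zero) X Y))
    (Signed.∣m∣n⇒∣m+n (Signed.∣n⇒∣m*n (x zero) tail) (Signed.∣m⇒∣m*n Y (h zero)))
  where
  X Y : ℤ
  X = ∏ℤ k (λ i → x (suc i))
  Y = ∏ℤ k (λ i → y (suc i))
  tail : n ∣ˢ X - Y
  tail = ∏-congruent k n (λ i → x (suc i)) (λ i → y (suc i)) (λ i → h (suc i))
  split : ∀ (x₀ y₀ X Y : ℤ) → x₀ * X - y₀ * Y ≡ x₀ * (X - Y) + (x₀ - y₀) * Y
  split = solve-∀

∏-scale : ∀ k (C : ℤ) (x : Fin k → ℤ) → ∏ℤ k (λ i → C * x i) ≡ C ^ k * ∏ℤ k x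
∏-scale ℕ.zero    C x = refl
∏-scale (ℕ.suc k) C x =
  trans (cong (C * x zero *_) (∏-scale k C (λ i → x (suc i))))
        (regroup C (x zero) (C ^ k) (∏ℤ k (λ i → x (suc i))))
  where
  regroup : ∀ (C x₀ P X : ℤ) → C * x₀ * (P * X) ≡ C * P * (x₀ * X)
  regroup = solve-∀

∏-nonzero : ∀ k (x : Fin k → ℤ) → (∀ i → ¬ x i ≡ + 0) → ¬ ∏ℤ k x ≡ + 0
∏-nonzero ℕ.zero    x h ()
∏-nonzero (ℕ.suc k) x h eq =
  [ h zero , ∏-nonzero k (λ i → x (suc i)) (λ i → h (suc i)) ] (ℤₚ.i*j≡0⇒i≡0∨j≡0 (x zero) eq)

∏ℕ-as-∏ℤ : ∀ k (x : Fin k → ℕ) → + ∏ℕ k x ≡ ∏ℤ k (λ i → + x i)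
∏ℕ-as-∏ℤ ℕ.zero    x = refl
∏ℕ-as-∏ℤ (ℕ.suc k) x =
  trans (ℤₚ.pos-* (x zero) (∏ℕ k (λ i → x (suc i))))
        (cong (+ x zero *_) (∏ℕ-as-∏ℤ k (λ i → x (suc i))))

pos-linear : ∀ (a b c : ℕ) → + (a ℕ.+ b ℕ.* c) ≡ + a + + b * + c
pos-linear a b c = trans (ℤₚ.pos-+ a (b ℕ.* c)) (cong (λ z → + a + z) (ℤₚ.pos-* b c))

pos-affine : ∀ (a s b : ℕ) → + (a ℕ.* s ℕ.+ b) ≡ + a * + s + + b
pos-affine a s b = trans (ℤₚ.pos-+ (a ℕ.* s) b) (cong (_+ + b) (ℤₚ.pos-* a s))

∣-congruent : ∀ {n X Y : ℤ} → n ∣ˢ X → n ∣ˢ X - Y → n ∣ˢ Y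
∣-congruent {n} {X} {Y} n∣X n∣X-Y = subst (n ∣ˢ_) (sub-sub X Y) (Signed.∣m∣n⇒∣m-n n∣X n∣X-Y)
  where
  sub-sub : ∀ (X Y : ℤ) → X - (X - Y) ≡ Y
  sub-sub = solve-∀

FixedDivisorFree : (k : ℕ) (a b : Fin k → ℤ) → Set
FixedDivisorFree k a b =
  ¬ (Σ ℤ λ n → + 1 < n × (∀ s → n ∣ ∏ℤ k (λ i → a i * s + b i)))

FixedDivisorFree-cong : ∀ k {a b a′ b′ : Fin k → ℤ} →
  (∀ i → a i ≡ a′ i) → (∀ i → b i ≡ b′ i) → FixedDivisorFree k a b → FixedDivisorFree k a′ b′
FixedDivisorFree-cong k ea eb free (n , 1<n , H) = free (n , 1<n , λ s → subst (n ∣_)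
  (∏-cong k (λ i → cong₂ _+_ (cong (_* s) (sym (ea i))) (sym (eb i)))) (H s))

∏-periodic : ∀ k (a b : Fin k → ℤ) (n s e : ℤ) →
  n ∣ˢ ∏ℤ k (λ i → a i * (s + n * e) + b i) → n ∣ˢ ∏ℤ k (λ i → a i * s + b i)
∏-periodic k a b n s e n∣shifted = ∣-congruent n∣shifted (∏-congruent k n _ _ termwise)
  where
  difference : ∀ (A s n e B : ℤ) → A * (s + n * e) + B - (A * s + B) ≡ A * e * n
  difference = solve-∀
  termwise : ∀ i → n ∣ˢ (a i * (s + n * e) + b i) - (a i * s + b i)
  termwise i = Signed.divides (a i * e) (difference (a i) s n e (b i))

inverse-mod : ∀ {n p : ℕ} → Coprime n p → Σ ℤ λ u → Σ ℤ λ w → u * + p ≡ + 1 + w * + n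
inverse-mod {n} {p} n⊥p with coprime-Bézout n⊥p
... | Bézout.+- x y eq = - + y , - + x , negate (+ y) (+ p) (+ x) (+ n)
        (trans (sym (pos-linear 1 y p)) (trans (cong +_ eq) (ℤₚ.pos-* x n)))
  where
  negate : ∀ (Y P X N : ℤ) → + 1 + Y * P ≡ X * N → (- Y) * P ≡ + 1 + (- X) * N
  negate Y P X N eq = begin
    (- Y) * P               ≡⟨ expand Y P ⟩
    + 1 + - (+ 1 + Y * P)   ≡⟨ cong (λ z → + 1 + - z) eq ⟩
    + 1 + - (X * N)         ≡⟨ pull X N ⟩
    + 1 + (- X) * N         ∎
    where
    open ≡-Reasoning
    expand : ∀ (Y P : ℤ) → (- Y) * P ≡ + 1 + - (+ 1 + Y * P)
    expand = solve-∀
    pull : ∀ (X N : ℤ) → + 1 + - (X * N) ≡ + 1 + (- X) * N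
    pull = solve-∀
... | Bézout.-+ x y eq = + y , + x ,
        sym (trans (sym (pos-linear 1 x n)) (trans (cong +_ eq) (ℤₚ.pos-* y p)))

-- Substituting s = p y + t, with p coprime to the product of the values at
-- t, keeps a system free of fixed divisors: a fixed divisor n of the new
-- system divides the values at t, so it is coprime to p, and as p is
-- invertible mod n every residue class of s is of the form p y + t.
FixedDivisorFree-substitute : ∀ k (a b : Fin k → ℤ) (p : ℕ) (t : ℤ) →
  FixedDivisorFree k a b → Coprime p ∣ ∏ℤ k (λ i → a i * t + b i) ∣ →
  FixedDivisorFree k (λ i → a i * + p) (λ i → a i * t + b i)
FixedDivisorFree-substitute k a b p t free p⊥values (-[1+ _ ] , () , _)
FixedDivisorFree-substitute k a b p t free p⊥values (+ n , 1<n , H) = free (+ n , 1<n , H′)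
  where
  at-t : + n ∣ ∏ℤ k (λ i → a i * t + b i)
  at-t = subst (+ n ∣_) (∏-cong k (λ i → vanish (a i) (+ p) (a i * t + b i))) (H (+ 0))
    where
    vanish : ∀ (A P B : ℤ) → A * P * + 0 + B ≡ B
    vanish = solve-∀
  n⊥p : Coprime n p
  n⊥p (d∣n , d∣p) = p⊥values (d∣p , ℕ∣.∣-trans d∣n at-t)
  u w : ℤ
  u = proj₁ (inverse-mod n⊥p)
  w = proj₁ (proj₂ (inverse-mod n⊥p))
  uw : u * + p ≡ + 1 + w * + n
  uw = proj₂ (proj₂ (inverse-mod n⊥p))
  H′ : ∀ s → + n ∣ ∏ℤ k (λ i → a i * s + b i)
  H′ s = Signed.∣⇒∣ᵤ (∏-periodic k a b (+ n) s (w * (s - t))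
           (Signed.∣ᵤ⇒∣ (subst (+ n ∣_) (∏-cong k hit) (H (u * (s - t))))))
    where
    hit : ∀ i → a i * + p * (u * (s - t)) + (a i * t + b i) ≡ a i * (s + + n * (w * (s - t))) + b i
    hit i = begin
      a i * + p * (u * (s - t)) + (a i * t + b i)     ≡⟨ reassoc (a i) (+ p) u s t (b i) ⟩
      a i * (u * + p * (s - t)) + (a i * t + b i)     ≡⟨ cong (λ z → a i * (z * (s - t)) + (a i * t + b i)) uw ⟩
      a i * ((+ 1 + w * + n) * (s - t)) + (a i * t + b i) ≡⟨ expand (a i) w (+ n) s t (b i) ⟩
      a i * (s + + n * (w * (s - t))) + b i           ∎
      where
      open ≡-Reasoning
      reassoc : ∀ (A P U S T B : ℤ) → A * P * (U * (S - T)) + (A * T + B) ≡ A * (U * P * (S - T)) + (A * T + B)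
      reassoc = solve-∀
      expand : ∀ (A W N S T B : ℤ) → A * ((+ 1 + W * N) * (S - T)) + (A * T + B) ≡ A * (S + N * (W * (S - T))) + B
      expand = solve-∀

-- For forms with natural coefficients, freedom from fixed divisors over ℤ
-- gives the hypothesis of Dickson's conjecture, which quantifies over
-- natural s only: the value at a negative s is congruent modulo n to a
-- value at a natural number.
FixedDivisorFree⇒ℕ : ∀ k (A B : Fin k → ℕ) → FixedDivisorFree k (λ i → + A i) (λ i → + B i) →
  ¬ (Σ ℕ λ n → 1 ℕ.< n × (∀ (s : ℕ) → n ℕ∣.∣ ∏ℕ k (λ i → A i ℕ.* s ℕ.+ B i)))
FixedDivisorFree⇒ℕ k A B free (ℕ.zero , () , _)
FixedDivisorFree⇒ℕ k A B free (ℕ.suc n , 1<n , H) = free (+ ℕ.suc n , +<+ 1<n , H′)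
  where
  atℕ : ∀ (s : ℕ) → + ℕ.suc n ∣ˢ ∏ℤ k (λ i → + A i * + s + + B i)
  atℕ s = Signed.∣ᵤ⇒∣ (subst (+ ℕ.suc n ∣_)
            (trans (∏ℕ-as-∏ℤ k _) (∏-cong k (λ i → pos-affine (A i) s (B i)))) (H s))
  H′ : ∀ s → + ℕ.suc n ∣ ∏ℤ k (λ i → + A i * s + + B i)
  H′ (+ s)     = Signed.∣⇒∣ᵤ (atℕ s)
  H′ -[1+ s ] = Signed.∣⇒∣ᵤ (∏-periodic k (λ i → + A i) (λ i → + B i) (+ ℕ.suc n) -[1+ s ] (+ ℕ.suc s)
                  (subst (λ z → + ℕ.suc n ∣ˢ ∏ℤ k (λ i → + A i * z + + B i)) (sym into-ℕ) (atℕ (n ℕ.* ℕ.suc s))))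
    where
    wrap : ∀ (n s : ℤ) → - s + (+ 1 + n) * s ≡ n * s
    wrap = solve-∀
    into-ℕ : -[1+ s ] + + ℕ.suc n * + ℕ.suc s ≡ + (n ℕ.* ℕ.suc s)
    into-ℕ = trans (wrap (+ n) (+ ℕ.suc s)) (sym (ℤₚ.pos-* n (ℕ.suc s)))

-- A common divisor of the values C t + D and ∏ (A i t + B i) divides the
-- product of the resultants C B i − D A i, as C (A t + B) − (C B − D A)
-- equals A (C t + D).
common-divisor∣resultant : ∀ k (A B : Fin k → ℤ) (C D t g : ℤ) →
  g ∣ˢ C * t + D → g ∣ˢ ∏ℤ k (λ i → A i * t + B i) → g ∣ˢ ∏ℤ k (λ i → C * B i - D * A i)
common-divisor∣resultant k A B C D t g g∣value g∣values =
  ∣-congruent g∣scaled (∏-congruent k g _ _ termwise)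
  where
  g∣scaled : g ∣ˢ ∏ℤ k (λ i → C * (A i * t + B i))
  g∣scaled = subst (g ∣ˢ_) (sym (∏-scale k C _)) (Signed.∣n⇒∣m*n (C ^ k) g∣values)
  eliminate : ∀ (C A t B D : ℤ) → C * (A * t + B) - (C * B - D * A) ≡ A * (C * t + D)
  eliminate = solve-∀
  termwise : ∀ i → g ∣ˢ C * (A i * t + B i) - (C * B i - D * A i)
  termwise i = subst (g ∣ˢ_) (sym (eliminate C (A i) t (B i) D)) (Signed.∣n⇒∣m*n (A i) g∣value)

-- Let the forms A i s + B i have no fixed divisor and let
-- C s + D (C ≥ 1) have all resultants C B i − D A i non-zero.  With K the
-- absolute value of their product, p = 1 + K² C and t = K² D, the value
-- C t + D is D p, while p is coprime to ∏ (A i t + B i) (a common divisor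
-- divides K, hence K² C, and 1 + K² C); so the forms A i (p y + t) + B i
-- still have no fixed divisor.
module Kill (k : ℕ) (A B : Fin k → ℤ) (C D : ℕ) (1≤C : 1 ℕ.≤ C)
            (resultant≢0 : ∀ i → ¬ + C * B i - + D * A i ≡ + 0) where

  resultant : Fin k → ℤ
  resultant i = + C * B i - + D * A i

  K : ℕ
  K = ∣ ∏ℤ k resultant ∣

  modulus : ℕ
  modulus = ℕ.suc (K ℕ.* K ℕ.* C)

  shift : ℕ
  shift = K ℕ.* K ℕ.* D

  1≤K : 1 ℕ.≤ K
  1≤K = ℕₚ.n≢0⇒n>0 (λ K≡0 → ∏-nonzero k resultant resultant≢0 (ℤₚ.∣i∣≡0⇒i≡0 K≡0))

  2≤modulus : 2 ℕ.≤ modulus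
  2≤modulus = ℕ.s≤s (ℕₚ.*-mono-≤ (ℕₚ.*-mono-≤ 1≤K 1≤K) 1≤C)

  value-at-shift : + C * + shift + + D ≡ + (D ℕ.* modulus)
  value-at-shift = begin
    + C * + shift + + D      ≡⟨ cong (_+ + D) (ℤₚ.pos-* C shift) ⟨
    + (C ℕ.* shift) + + D    ≡⟨ ℤₚ.pos-+ (C ℕ.* shift) D ⟨
    + (C ℕ.* shift ℕ.+ D)    ≡⟨ cong +_ (factor C K D) ⟩
    + (D ℕ.* modulus)        ∎
    where
    open ≡-Reasoning
    factor : ∀ C K D → C ℕ.* (K ℕ.* K ℕ.* D) ℕ.+ D ≡ D ℕ.* ℕ.suc (K ℕ.* K ℕ.* C)
    factor = ℕRing.solve-∀

  modulus⊥values : Coprime modulus ∣ ∏ℤ k (λ i → A i * + shift + B i) ∣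
  modulus⊥values {g} (g∣modulus , g∣values) = ℕ∣.∣1⇒≡1 (ℕ∣.∣m+n∣m⇒∣n g∣modulus′ g∣K²C)
    where
    g∣modulus′ : g ℕ∣.∣ K ℕ.* K ℕ.* C ℕ.+ 1
    g∣modulus′ = subst (g ℕ∣.∣_) (ℕₚ.+-comm 1 (K ℕ.* K ℕ.* C)) g∣modulus
    g∣value : + g ∣ˢ + C * + shift + + D
    g∣value = subst (+ g ∣ˢ_) (sym value-at-shift)
                (Signed.∣ᵤ⇒∣ (ℕ∣.∣-trans g∣modulus (ℕ∣.∣n⇒∣m*n D ℕ∣.∣-refl)))
    g∣K : g ℕ∣.∣ K
    g∣K = Signed.∣⇒∣ᵤ (common-divisor∣resultant k A B (+ C) (+ D) (+ shift) (+ g)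
            g∣value (Signed.∣ᵤ⇒∣ g∣values))
    g∣K²C : g ℕ∣.∣ K ℕ.* K ℕ.* C
    g∣K²C = ℕ∣.∣m⇒∣m*n C (ℕ∣.∣m⇒∣m*n K g∣K)

  substituted-free : FixedDivisorFree k A B →
    FixedDivisorFree k (λ i → A i * + modulus) (λ i → A i * + shift + B i)
  substituted-free free = FixedDivisorFree-substitute k A B modulus (+ shift) free modulus⊥values

absorb : ∀ (b : ℤ) (y : ℕ) → Σ ℕ λ z → + (∣ b ∣ ℕ.+ y) + b ≡ + (y ℕ.+ z)
absorb (+ b) y = b ℕ.+ b , cong +_ (rearrange b y)
  where
  rearrange : ∀ b y → b ℕ.+ y ℕ.+ b ≡ y ℕ.+ (b ℕ.+ b)
  rearrange = ℕRing.solve-∀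
absorb -[1+ b ] y = 0 , trans (ℤₚ.⊖-≥ (ℕₚ.m≤m+n (ℕ.suc b) y))
  (cong +_ (trans (ℕₚ.m+n∸m≡n (ℕ.suc b) y) (sym (ℕₚ.+-identityʳ y))))

value-exceeds : ∀ (a : ℤ) (u m : ℕ) (b : ℤ) → + 1 ≤ a → ℕ.suc (u ℕ.+ ∣ b ∣) ℕ.≤ m →
                Σ ℕ λ v → (a * + m + b ≡ + v) × u ℕ.< v
value-exceeds (+ ℕ.zero) u m b (+≤+ ())
value-exceeds (+ ℕ.suc a) u m b _ u+|b|<m with ℕₚ.m≤n⇒∃[o]m+o≡n u+|b|<m
... | r , refl = y ℕ.+ z , value≡ , ℕₚ.≤-trans u<y (ℕₚ.m≤m+n y z)
  where
  y z : ℕ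
  y = ℕ.suc u ℕ.+ r ℕ.+ a ℕ.* m
  z = proj₁ (absorb b y)
  expand : ∀ a u B r → ℕ.suc a ℕ.* (ℕ.suc (u ℕ.+ B) ℕ.+ r) ≡ B ℕ.+ (ℕ.suc u ℕ.+ r ℕ.+ a ℕ.* (ℕ.suc (u ℕ.+ B) ℕ.+ r))
  expand = ℕRing.solve-∀
  value≡ : + ℕ.suc a * + m + b ≡ + (y ℕ.+ z)
  value≡ = trans (cong (_+ b) (trans (sym (ℤₚ.pos-* (ℕ.suc a) m)) (cong +_ (expand a u ∣ b ∣ r))))
                 (proj₂ (absorb b y))
  u<y : u ℕ.< y
  u<y = ℕₚ.≤-trans (ℕₚ.m≤m+n (ℕ.suc u) r) (ℕₚ.m≤m+n _ _)

1<prime : ∀ {q} → Prime q → 1 ℕ.< q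
1<prime {0} q-prime = ⊥-elim (¬prime[0] q-prime)
1<prime {1} q-prime = ⊥-elim (¬prime[1] q-prime)
1<prime {ℕ.suc (ℕ.suc _)} _ = ℕ.s≤s (ℕ.s≤s ℕ.z≤n)

composite-by-divisor : ∀ {p v} → 1 ℕ.< p → p ℕ.< v → p ℕ∣.∣ v → Composite v
composite-by-divisor {p} 1<p p<v p∣v =
  hasNonTrivialDivisor {divisor = p} {{ℕ.n>1⇒nonTrivial 1<p}} p<v p∣v

composite-by-modulus : ∀ (c d : ℤ) (m p : ℕ) → + 1 ≤ c → 2 ℕ.≤ p →
  + p ∣ˢ c * + m + d → ℕ.suc (p ℕ.+ ∣ d ∣) ℕ.≤ m → IsCompositeℤ (c * + m + d)
composite-by-modulus c d m p 1≤c 2≤p p∣value large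
  with value-exceeds c p m d 1≤c large
... | v , value≡v , p<v =
  v , value≡v , composite-by-divisor 2≤p p<v (subst (λ z → p ℕ∣.∣ ∣ z ∣) value≡v (Signed.∣⇒∣ᵤ p∣value))

-- If c q = a g for a prime q > a ≥ 1 and 1 ≤ c ≠ a, then g is composite:
-- q does not divide a, so g = w q and c = a w, where w = 0, 1 are excluded.
composite-cofactor : ∀ {a c q g : ℕ} → Prime q → ℕ.suc a ℕ.< q → 1 ℕ.≤ c →
  ¬ c ≡ ℕ.suc a → c ℕ.* q ≡ ℕ.suc a ℕ.* g → Composite g
composite-cofactor {a} {c} {q} {g} q-prime a<q 1≤c c≢a cq≡ag
  with euclidsLemma (ℕ.suc a) g q-prime (ℕ∣.divides c (sym cq≡ag))
... | inj₁ q∣a = ⊥-elim (ℕₚ.<⇒≱ a<q (ℕ∣.∣⇒≤ q∣a))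
... | inj₂ (ℕ∣.divides w g≡wq) = cofactor w g≡wq c≡aw
  where
  1<q : 1 ℕ.< q
  1<q = 1<prime q-prime
  c≡aw : c ≡ ℕ.suc a ℕ.* w
  c≡aw = ℕₚ.*-cancelʳ-≡ c (ℕ.suc a ℕ.* w) q {{ℕ.>-nonZero (ℕₚ.<-trans (ℕ.s≤s ℕ.z≤n) 1<q)}}
           (trans cq≡ag (trans (cong (ℕ.suc a ℕ.*_) g≡wq) (sym (ℕₚ.*-assoc (ℕ.suc a) w q))))
  cofactor : ∀ w → g ≡ w ℕ.* q → c ≡ ℕ.suc a ℕ.* w → Composite g
  cofactor ℕ.zero _ c≡0 = ⊥-elim (ℕₚ.<⇒≢ 1≤c (sym (trans c≡0 (ℕₚ.*-zeroʳ (ℕ.suc a)))))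
  cofactor (ℕ.suc ℕ.zero) _ c≡a = ⊥-elim (c≢a (trans c≡a (ℕₚ.*-identityʳ (ℕ.suc a))))
  cofactor (ℕ.suc (ℕ.suc w)) g≡wq _ =
    composite-by-divisor 1<q q<g (ℕ∣.divides (ℕ.suc (ℕ.suc w)) g≡wq)
    where
    q<g : q ℕ.< g
    q<g = subst (q ℕ.<_) (sym g≡wq)
            (ℕₚ.m<m+n q (ℕₚ.<-≤-trans (ℕₚ.<-trans (ℕ.s≤s ℕ.z≤n) 1<q) (ℕₚ.m≤m+n q _)))

IsNat : ℤ → Set
IsNat z = Σ ℕ λ v → z ≡ + v

natural-cofactor : ∀ {a n : ℕ} (G : ℤ) → + n ≡ + ℕ.suc a * G → IsNat G
natural-cofactor (+ g)    _  = g , refl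
natural-cofactor -[1+ g ] ()

proportional-values : ∀ (a b c d m : ℤ) → a * d ≡ b * c → c * (a * m + b) ≡ a * (c * m + d)
proportional-values a b c d m ad≡bc = begin
  c * (a * m + b)          ≡⟨ expand a c m b ⟩
  a * (c * m) + b * c      ≡⟨ cong (λ z → a * (c * m) + z) ad≡bc ⟨
  a * (c * m) + a * d      ≡⟨ ℤₚ.*-distribˡ-+ a (c * m) d ⟨
  a * (c * m + d)          ∎
  where
  open ≡-Reasoning
  expand : ∀ (a c m b : ℤ) → c * (a * m + b) ≡ a * (c * m) + b * c
  expand = solve-∀

-- The proportional case: if a d = b c with (a , b) ≠ (c , d), and a m + b is
-- a prime q > a, then c m + d is composite, because c q = a (c m + d).
composite-proportional : ∀ (a b c d : ℤ) (m : ℕ) → + 1 ≤ a → + 1 ≤ c →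
  a * d ≡ b * c → ¬ (a , b) ≡ (c , d) → IsPrimeℤ (a * + m + b) →
  ℕ.suc (∣ a ∣ ℕ.+ ∣ b ∣) ℕ.≤ m → IsCompositeℤ (c * + m + d)
composite-proportional (+ ℕ.zero) b c d m (+≤+ ()) _ _ _ _ _
composite-proportional (+ ℕ.suc a) b (+ c) d m 1≤a (+≤+ 1≤c) ad≡bc distinct (q , value≡q , q-prime) large
  with value-exceeds (+ ℕ.suc a) (ℕ.suc a) m b 1≤a large
... | v , value≡v , a<v = g , G≡g , composite-cofactor q-prime a<q 1≤c c≢a cq≡ag
  where
  cq≡aG : + c * + q ≡ + ℕ.suc a * (+ c * + m + d)
  cq≡aG = trans (cong (+ c *_) (sym value≡q)) (proportional-values (+ ℕ.suc a) b (+ c) d (+ m) ad≡bc)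
  G-natural : IsNat (+ c * + m + d)
  G-natural = natural-cofactor {a = a} (+ c * + m + d) (trans (ℤₚ.pos-* c q) cq≡aG)
  g : ℕ
  g = proj₁ G-natural
  G≡g : + c * + m + d ≡ + g
  G≡g = proj₂ G-natural
  a<q : ℕ.suc a ℕ.< q
  a<q = subst (ℕ.suc a ℕ.<_) (cong ∣_∣ (trans (sym value≡v) value≡q)) a<v
  cq≡ag : c ℕ.* q ≡ ℕ.suc a ℕ.* g
  cq≡ag = cong ∣_∣ (trans (ℤₚ.pos-* c q) (trans cq≡aG (trans (cong (+ ℕ.suc a *_) G≡g) (sym (ℤₚ.pos-* (ℕ.suc a) g)))))
  c≢a : ¬ c ≡ ℕ.suc a
  c≢a refl = distinct (cong (+ ℕ.suc a ,_)
    (ℤₚ.*-cancelˡ-≡ (+ ℕ.suc a) b d (trans (ℤₚ.*-comm (+ ℕ.suc a) b) (sym ad≡bc))))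

IsNat-large : ∀ (a b : ℤ) (T : ℕ) → + 1 ≤ a → ∣ b ∣ ℕ.< T → IsNat (a * + T + b)
IsNat-large a b T 1≤a |b|<T = let v , value≡v , _ = value-exceeds a 0 T b 1≤a |b|<T in v , value≡v

sumℕ : (k : ℕ) → (Fin k → ℕ) → ℕ
sumℕ ℕ.zero    x = 0
sumℕ (ℕ.suc k) x = x zero ℕ.+ sumℕ k (λ i → x (suc i))

≤-sumℕ : ∀ k (x : Fin k → ℕ) i → x i ℕ.≤ sumℕ k x
≤-sumℕ (ℕ.suc k) x zero    = ℕₚ.m≤m+n (x zero) _
≤-sumℕ (ℕ.suc k) x (suc i) = ℕₚ.≤-trans (≤-sumℕ k (λ i → x (suc i)) i) (ℕₚ.m≤n+m _ (x zero))

value-along : ∀ (c d : ℤ) (R M f : ℕ) → c * + (R ℕ.+ M ℕ.* f) + d ≡ (c * + R + d) + c * + M * + f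
value-along c d R M f = trans (cong (λ z → c * z + d) (pos-linear R M f)) (expand c (+ R) (+ M) (+ f) d)
  where
  expand : ∀ (c R M f d : ℤ) → c * (R + M * f) + d ≡ (c * R + d) + c * M * f
  expand = solve-∀

divides-along : ∀ {p : ℤ} (c d : ℤ) (R M f : ℕ) → p ∣ˢ c * + M → p ∣ˢ c * + R + d →
                p ∣ˢ c * + (R ℕ.+ M ℕ.* f) + d
divides-along {p} c d R M f p∣cM p∣cR+d = subst (p ∣ˢ_) (sym (value-along c d R M f))
  (Signed.∣m∣n⇒∣m+n p∣cR+d (Signed.∣m⇒∣m*n (+ f) p∣cM))

index≤member : ∀ {M} R x → 1 ℕ.≤ M → x ℕ.≤ R ℕ.+ M ℕ.* x
index≤member {M} R x 1≤M = ℕₚ.≤-trans (ℕₚ.m≤n*m x M {{ℕ.>-nonZero 1≤M}}) (ℕₚ.m≤n+m _ R)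

Refines : (M R M′ R′ : ℕ) → Set
Refines M R M′ R′ = Σ ℕ λ e → Σ ℕ λ f → (M′ ≡ M ℕ.* e) × (R′ ≡ R ℕ.+ M ℕ.* f)

Refines-refl : ∀ M R → Refines M R M R
Refines-refl M R = 1 , 0 , sym (ℕₚ.*-identityʳ M) , sym (trans (cong (R ℕ.+_) (ℕₚ.*-zeroʳ M)) (ℕₚ.+-identityʳ R))

Refines-trans : ∀ {M R M₁ R₁ M₂ R₂} → Refines M R M₁ R₁ → Refines M₁ R₁ M₂ R₂ → Refines M R M₂ R₂
Refines-trans {M} {R} (e₁ , f₁ , refl , refl) (e₂ , f₂ , refl , refl) =
  e₁ ℕ.* e₂ , f₁ ℕ.+ e₁ ℕ.* f₂ , ℕₚ.*-assoc M e₁ e₂ , regroup R M f₁ e₁ f₂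
  where
  regroup : ∀ R M f₁ e₁ f₂ → R ℕ.+ M ℕ.* f₁ ℕ.+ M ℕ.* e₁ ℕ.* f₂ ≡ R ℕ.+ M ℕ.* (f₁ ℕ.+ e₁ ℕ.* f₂)
  regroup = ℕRing.solve-∀

-- For c ≥ 1 the value c R + d only grows along a refinement, so it stays natural.
IsNat-refine : ∀ (c d : ℤ) {M R M′ R′} → + 1 ≤ c → Refines M R M′ R′ → IsNat (c * + R + d) → IsNat (c * + R′ + d)
IsNat-refine (+ c) d {M} {R} _ (_ , f , _ , refl) (v , value≡v) = v ℕ.+ c ℕ.* M ℕ.* f , (begin
  + c * + (R ℕ.+ M ℕ.* f) + d      ≡⟨ value-along (+ c) d R M f ⟩
  (+ c * + R + d) + + c * + M * + f ≡⟨ cong₂ _+_ value≡v increment ⟩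
  + v + + (c ℕ.* M ℕ.* f)            ≡⟨ ℤₚ.pos-+ v _ ⟨
  + (v ℕ.+ c ℕ.* M ℕ.* f)            ∎)
  where
  open ≡-Reasoning
  increment : + c * + M * + f ≡ + (c ℕ.* M ℕ.* f)
  increment = sym (trans (ℤₚ.pos-* (c ℕ.* M) f) (cong (_* + f) (ℤₚ.pos-* c M)))

module Sieve (k : ℕ) (a b : Fin k → ℤ) (1≤a : ∀ i → + 1 ≤ a i) where

  -- R + M ℕ is admissible when M ≥ 1, the forms x ↦ f i (R + M x), i.e.
  -- a i M x + (a i R + b i), have no fixed divisor, and their constant
  -- terms are natural numbers (so that Dickson's conjecture applies).
  Admissible : ℕ → ℕ → Set
  Admissible M R = 1 ℕ.≤ M × FixedDivisorFree k (λ i → a i * + M) (λ i → a i * + R + b i)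
                 × (∀ i → IsNat (a i * + R + b i))

  Sieved : ℤ → ℤ → ℕ → ℕ → Set
  Sieved c d M R = (Σ (Fin k) λ i → a i * d ≡ b i * c)
                 ⊎ (Σ ℕ λ p → 2 ℕ.≤ p × + p ∣ˢ c * + M × + p ∣ˢ c * + R + d)

  Sieved-refine : ∀ {c d M R M′ R′} → Refines M R M′ R′ → Sieved c d M R → Sieved c d M′ R′
  Sieved-refine _ (inj₁ proportional) = inj₁ proportional
  Sieved-refine {c} {d} {M} {R} (e , f , refl , refl) (inj₂ (p , 2≤p , p∣cM , p∣cR+d)) =
    inj₂ (p , 2≤p , p∣cMe , p∣value)
    where
    p∣cMe : + p ∣ˢ c * + (M ℕ.* e)
    p∣cMe = subst (+ p ∣ˢ_) (trans (ℤₚ.*-assoc c (+ M) (+ e)) (cong (c *_) (sym (ℤₚ.pos-* M e))))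
              (Signed.∣m⇒∣m*n (+ e) p∣cM)
    p∣value : + p ∣ˢ c * + (R ℕ.+ M ℕ.* f) + d
    p∣value = divides-along c d R M f p∣cM p∣cR+d

  start : FixedDivisorFree k a b → (T : ℕ) → (∀ i → ∣ b i ∣ ℕ.< T) → Admissible 1 T
  start free T large = ℕₚ.≤-refl , FixedDivisorFree-substitute k a b 1 (+ T) free (1-coprimeTo _)
                     , λ i → IsNat-large (a i) (b i) T (1≤a i) (large i)

  -- Sieving a form that is not proportional to any f i, via Kill applied to
  -- the forms in the variable x of the progression.
  kill-step : ∀ M R (c d : ℤ) → Admissible M R → + 1 ≤ c → IsNat (c * + R + d) →
    (∀ i → ¬ a i * d ≡ b i * c) →
    Σ ℕ λ M′ → Σ ℕ λ R′ → Admissible M′ R′ × Refines M R M′ R′ × Sieved c d M′ R′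
  kill-step M R (+ c) d (1≤M , free , nat) (+≤+ 1≤c) (D , cR+d≡D) not-proportional =
    M ℕ.* p , R ℕ.+ M ℕ.* t , (1≤Mp , free′ , nat′) , refinement , inj₂ (p , 2≤modulus , p∣cMp , p∣value)
    where
    A B : Fin k → ℤ
    A i = a i * + M
    B i = a i * + R + b i
    resultant≡ : ∀ i → + (c ℕ.* M) * B i - + D * A i ≡ + M * (+ c * b i - d * a i)
    resultant≡ i = trans (cong₂ (λ C D → C * B i - D * A i) (ℤₚ.pos-* c M) (sym cR+d≡D))
                         (expand (+ c) (+ M) (+ R) d (a i) (b i))
      where
      expand : ∀ (c M R d a b : ℤ) → c * M * (a * R + b) - (c * R + d) * (a * M) ≡ M * (c * b - d * a)
      expand = solve-∀
    resultant≢0 : ∀ i → ¬ + (c ℕ.* M) * B i - + D * A i ≡ + 0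
    resultant≢0 i eq with ℤₚ.i*j≡0⇒i≡0∨j≡0 (+ M) (trans (sym (resultant≡ i)) eq)
    ... | inj₁ M≡0   = ℕₚ.<⇒≢ 1≤M (sym (cong ∣_∣ M≡0))
    ... | inj₂ cb≡da = not-proportional i (trans (ℤₚ.*-comm (a i) d)
                         (trans (sym (ℤₚ.i-j≡0⇒i≡j _ _ cb≡da)) (ℤₚ.*-comm (+ c) (b i))))
    open Kill k A B (c ℕ.* M) D (ℕₚ.*-mono-≤ 1≤c 1≤M) resultant≢0 renaming (modulus to p; shift to t)
    refinement : Refines M R (M ℕ.* p) (R ℕ.+ M ℕ.* t)
    refinement = p , t , refl , refl
    1≤Mp : 1 ℕ.≤ M ℕ.* p
    1≤Mp = ℕₚ.*-mono-≤ 1≤M (ℕ.s≤s ℕ.z≤n)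
    free′ : FixedDivisorFree k (λ i → a i * + (M ℕ.* p)) (λ i → a i * + (R ℕ.+ M ℕ.* t) + b i)
    free′ = FixedDivisorFree-cong k
      (λ i → trans (ℤₚ.*-assoc (a i) (+ M) (+ p)) (cong (a i *_) (sym (ℤₚ.pos-* M p))))
      (λ i → trans (ℤₚ.+-comm _ (B i)) (sym (value-along (a i) (b i) R M t)))
      (substituted-free free)
    nat′ : ∀ i → IsNat (a i * + (R ℕ.+ M ℕ.* t) + b i)
    nat′ i = IsNat-refine (a i) (b i) {M} {R} (1≤a i) refinement (nat i)
    p∣cMp : + p ∣ˢ + c * + (M ℕ.* p)
    p∣cMp = Signed.divides (+ c * + M) (trans (cong (+ c *_) (ℤₚ.pos-* M p)) (sym (ℤₚ.*-assoc (+ c) (+ M) (+ p))))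
    p∣value : + p ∣ˢ + c * + (R ℕ.+ M ℕ.* t) + d
    p∣value = Signed.divides (+ D) (begin
      + c * + (R ℕ.+ M ℕ.* t) + d        ≡⟨ value-along (+ c) d R M t ⟩
      (+ c * + R + d) + + c * + M * + t  ≡⟨ cong₂ (λ u C → u + C * + t) (sym cR+d≡D) (ℤₚ.pos-* c M) ⟨
      + D + + (c ℕ.* M) * + t            ≡⟨ ℤₚ.+-comm (+ D) (+ (c ℕ.* M) * + t) ⟩
      + (c ℕ.* M) * + t + + D            ≡⟨ value-at-shift ⟩
      + (D ℕ.* p)                        ≡⟨ ℤₚ.pos-* D p ⟩
      + D * + p                          ∎)
      where open ≡-Reasoning

  sieve-one : ∀ M R (c d : ℤ) → Admissible M R → + 1 ≤ c → IsNat (c * + R + d) →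
    Σ ℕ λ M′ → Σ ℕ λ R′ → Admissible M′ R′ × Refines M R M′ R′ × Sieved c d M′ R′
  sieve-one M R c d admissible 1≤c nat with any? (λ i → a i * d ℤₚ.≟ b i * c)
  ... | yes proportional   = M , R , admissible , Refines-refl M R , inj₁ proportional
  ... | no  not-proportional =
    kill-step M R c d admissible 1≤c nat (λ i eq → not-proportional (i , eq))

  -- Sieving finitely many forms one after another; earlier forms stay
  -- sieved because sieving is stable under refinement.
  sieve-all : ∀ k′ (c d : Fin k′ → ℤ) → (∀ j → + 1 ≤ c j) → ∀ {M R} → Admissible M R →
    (∀ j → IsNat (c j * + R + d j)) →
    Σ ℕ λ M′ → Σ ℕ λ R′ → Admissible M′ R′ × Refines M R M′ R′ × (∀ j → Sieved (c j) (d j) M′ R′)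
  sieve-all ℕ.zero c d 1≤c {M} {R} admissible nat = M , R , admissible , Refines-refl M R , λ ()
  sieve-all (ℕ.suc k′) c d 1≤c {M} {R} admissible nat
    with sieve-one M R (c zero) (d zero) admissible (1≤c zero) (nat zero)
  ... | M₁ , R₁ , admissible₁ , refines₁ , sieved₀
    with sieve-all k′ (λ j → c (suc j)) (λ j → d (suc j)) (λ j → 1≤c (suc j)) admissible₁
           (λ j → IsNat-refine (c (suc j)) (d (suc j)) {M} {R} (1≤c (suc j)) refines₁ (nat (suc j)))
  ... | M₂ , R₂ , admissible₂ , refines₂ , sieved =
    M₂ , R₂ , admissible₂ , Refines-trans {M} {R} refines₁ refines₂ ,
    λ { zero → Sieved-refine refines₂ sieved₀ ; (suc j) → sieved j }

  -- Dickson's conjecture applied to the forms x ↦ f i (R + M x), whose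
  -- coefficients |a i| M and a i R + b i are natural numbers.
  primes-in-progression : Dickson → ∀ {M R} → Admissible M R →
    ∀ N → Σ ℕ λ x → N ℕ.≤ x × (∀ i → IsPrimeℤ (a i * + (R ℕ.+ M ℕ.* x) + b i))
  primes-in-progression dickson {M} {R} (1≤M , free , nat) N =
    let x , N≤x , primes = dickson k A B 1≤A (FixedDivisorFree⇒ℕ k A B free′) N
    in x , N≤x , λ i → A i ℕ.* x ℕ.+ B i , value≡ x i , primes i
    where
    A B : Fin k → ℕ
    A i = ∣ a i ∣ ℕ.* M
    B i = proj₁ (nat i)
    1≤A : ∀ i → 1 ℕ.≤ A i
    1≤A i with a i | 1≤a i
    ... | + _ | +≤+ 1≤∣a∣ = ℕₚ.*-mono-≤ 1≤∣a∣ 1≤M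
    A≡ : ∀ i → a i * + M ≡ + A i
    A≡ i = trans (cong (_* + M) (sym (ℤₚ.0≤i⇒+∣i∣≡i (ℤₚ.≤-trans (+≤+ ℕ.z≤n) (1≤a i)))))
                 (sym (ℤₚ.pos-* ∣ a i ∣ M))
    free′ : FixedDivisorFree k (λ i → + A i) (λ i → + B i)
    free′ = FixedDivisorFree-cong k A≡ (λ i → proj₂ (nat i)) free
    value≡ : ∀ x i → a i * + (R ℕ.+ M ℕ.* x) + b i ≡ + (A i ℕ.* x ℕ.+ B i)
    value≡ x i = begin
      a i * + (R ℕ.+ M ℕ.* x) + b i         ≡⟨ value-along (a i) (b i) R M x ⟩
      (a i * + R + b i) + a i * + M * + x   ≡⟨ cong₂ (λ u v → u + v * + x) (proj₂ (nat i)) (A≡ i) ⟩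
      + B i + + A i * + x                   ≡⟨ ℤₚ.+-comm (+ B i) (+ A i * + x) ⟩
      + A i * + x + + B i                   ≡⟨ pos-affine (A i) x (B i) ⟨
      + (A i ℕ.* x ℕ.+ B i)                 ∎
      where open ≡-Reasoning

  CompositeBeyond : ℕ → ℕ → ℤ → ℤ → ℕ → Set
  CompositeBeyond M R c d β = ∀ x → β ℕ.≤ R ℕ.+ M ℕ.* x →
    (∀ i → IsPrimeℤ (a i * + (R ℕ.+ M ℕ.* x) + b i)) → IsCompositeℤ (c * + (R ℕ.+ M ℕ.* x) + d)

  sieved⇒composite : ∀ {M R} (c d : ℤ) → + 1 ≤ c → (∀ i → ¬ (a i , b i) ≡ (c , d)) →
    Sieved c d M R → Σ ℕ (CompositeBeyond M R c d)
  sieved⇒composite c d 1≤c distinct (inj₁ (i , ad≡bc)) =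
    ℕ.suc (∣ a i ∣ ℕ.+ ∣ b i ∣) , λ x large primes →
      composite-proportional (a i) (b i) c d _ (1≤a i) 1≤c ad≡bc (distinct i) (primes i) large
  sieved⇒composite {M} {R} c d 1≤c distinct (inj₂ (p , 2≤p , p∣cM , p∣cR+d)) =
    ℕ.suc (p ℕ.+ ∣ d ∣) , λ x large _ →
      composite-by-modulus c d _ p 1≤c 2≤p (divides-along c d R M x p∣cM p∣cR+d) large

  composites-beyond : ∀ k′ (c d : Fin k′ → ℤ) → (∀ j → + 1 ≤ c j) →
    (∀ i j → ¬ (a i , b i) ≡ (c j , d j)) → ∀ {M R} → (∀ j → Sieved (c j) (d j) M R) →
    Σ ℕ λ β → ∀ j → CompositeBeyond M R (c j) (d j) β
  composites-beyond k′ c d 1≤c distinct {M} {R} sieved =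
    sumℕ k′ β , λ j x large → proj₂ (bound j) x (ℕₚ.≤-trans (≤-sumℕ k′ β j) large)
    where
    bound : ∀ j → Σ ℕ (CompositeBeyond M R (c j) (d j))
    bound j = sieved⇒composite (c j) (d j) (1≤c j) (λ i → distinct i j) (sieved j)
    β : Fin k′ → ℕ
    β j = proj₁ (bound j)

lemma2p3 : Dickson →
    (k k′ : ℕ) (a b : Fin k → ℤ) (c d : Fin k′ → ℤ) →
    (∀ i → + 1 ≤ a i) → (∀ j → + 1 ≤ c j) →
    ¬ (Σ ℤ λ n → + 1 < n × (∀ (s : ℤ) → n ∣ ∏ℤ k (λ i → a i * s + b i))) →
    (∀ i j → ¬ ((a i , b i) ≡ (c j , d j))) →
    InfinitelyMany (λ m → (∀ i → IsPrimeℤ (a i * + m + b i)) × (∀ j → IsCompositeℤ (c j * + m + d j)))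
lemma2p3 dickson k k′ a b c d 1≤a 1≤c free distinct N =
  let open Sieve k a b 1≤a
      Sb : ℕ
      Sb = sumℕ k (λ i → ∣ b i ∣)
      Sd : ℕ
      Sd = sumℕ k′ (λ j → ∣ d j ∣)
      T : ℕ
      T = ℕ.suc (Sb ℕ.+ Sd)
      b<T : ∀ i → ∣ b i ∣ ℕ.< T
      b<T i = ℕ.s≤s (ℕₚ.≤-trans (≤-sumℕ k (λ i → ∣ b i ∣) i) (ℕₚ.m≤m+n Sb Sd))
      d<T : ∀ j → ∣ d j ∣ ℕ.< T
      d<T j = ℕ.s≤s (ℕₚ.≤-trans (≤-sumℕ k′ (λ j → ∣ d j ∣) j) (ℕₚ.m≤n+m Sd Sb))
      M , R , admissible , _ , sieved = sieve-all k′ c d 1≤c (start free T b<T)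
                                          (λ j → IsNat-large (c j) (d j) T (1≤c j) (d<T j))
      β , composite = composites-beyond k′ c d 1≤c distinct sieved
      x , N+β≤x , primes = primes-in-progression dickson admissible (N ℕ.+ β)
      N+β≤m : N ℕ.+ β ℕ.≤ R ℕ.+ M ℕ.* x
      N+β≤m = ℕₚ.≤-trans N+β≤x (index≤member R x (proj₁ admissible))
  in  R ℕ.+ M ℕ.* x , ℕₚ.≤-trans (ℕₚ.m≤m+n N β) N+β≤m , primes ,
      λ j → composite j x (ℕₚ.≤-trans (ℕₚ.m≤n+m β N) N+β≤m) primes
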